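{- Let $n\ge2$, $\boldsymbol a\in\{0,1\}^{n-1}$, $\vec\sigma\in\{0,1\}^n$, $0\le j_2\le n-2$, $\boldsymbol j=(-1,j_2)$ and $\boldsymbol m=(0,m_2)$ with $m_2=\sum_{k=1}^{j_2}s_k2^{j_2-k}\in\{0,\dots,2^{j_2}-1\}$, $s_k\in\{0,1\}$. Then the Haar coefficient of $\Delta(\cdot,\mathcal{P}_{\boldsymbol a}(\vec\sigma))$ is $$\mu_{\boldsymbol j,\boldsymbol m}=2^{ -2n-2}-2^{ -n-j_2-3}-2^{ -2n-1}(\sigma_{j_2+1}\oplus a_{j_2+1}\sigma_n)+2^{ -2j_2-3}\sum_{k=1}^{j_2}\frac{s_k\oplus\sigma_k+s_k\oplus\sigma_k'}{2^{n+1-k}},$$ where $\sigma_k'=\sigma_k\oplus a_k$ and the terms $s_k\oplus\sigma_k$, $s_k\oplus\sigma_k'$ are added as integers.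
   Context: $\oplus$ denotes addition modulo 2. For an integer $n\ge1$, $\boldsymbol{a}=(a_1,\dots,a_{n-1})\in\{0,1\}^{n-1}$ and $\vec{\sigma}=(\sigma_1,\dots,\sigma_n)\in\{0,1\}^n$, let $\mathcal{P}_{\boldsymbol{a}}(\vec{\sigma})\subset[0,1)^2$ be the set of the $2^n$ points $\bigl(\frac{t_n}{2}+\dots+\frac{t_1}{2^n},\ \frac{b_1}{2}+\dots+\frac{b_n}{2^n}\bigr)$, $(t_1,\dots,t_n)\in\{0,1\}^n$, with $b_k=t_k\oplus a_kt_n\oplus\sigma_k$ for $1\le k\le n-1$ and $b_n=t_n\oplus\sigma_n$. For an $N$-point set $\mathcal{P}$ the discrepancy function is $\Delta(\boldsymbol{t},\mathcal{P})=\frac1N\#\{\boldsymbol{z}\in\mathcal{P}:\boldsymbol{z}\in[0,t_1)\times[0,t_2)\}-t_1t_2$. Haar functions: for $j\ge0$, $m\in\{0,\dots,2^j-1\}$, $h_{j,m}$ is $+1$ on $[m2^{ -j},(m+\frac12)2^{ -j})$, $-1$ on $[(m+\frac12)2^{ -j},(m+1)2^{ -j})$ and $0$ elsewhere on $[0,1)$; $h_{ -1,0}=\mathbf 1_{[0,1)}$. For $\boldsymbol j=(j_1,j_2)$, $\boldsymbol m=(m_1,m_2)$, $h_{\boldsymbol j,\boldsymbol m}(\boldsymbol t)=h_{j_1,m_1}(t_1)h_{j_2,m_2}(t_2)$ and the Haar coefficient is $\mu_{\boldsymbol j,\boldsymbol m}=\int_{[0,1)^2}\Delta(\boldsymbol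 t,\mathcal P)h_{\boldsymbol j,\boldsymbol m}(\boldsymbol t)\,d\boldsymbol t$. -}

module Defs where

open import Data.Bool using (Bool; true; false; _xor_; _∧_; if_then_else_)
open import Data.Nat as ℕ using (ℕ; zero; suc; _<_)
open import Data.Fin using (Fin; zero; suc; fromℕ; fromℕ<; inject₁; toℕ)
open import Data.Rational using (ℚ; 0ℚ; 1ℚ; ½; _+_; _-_; _*_; _⊔_; _⊓_)
import Data.Rational as Q
import Data.Integer
open import Relation.Nullary using (yes; no)
open import Data.Vec.Functional using (Vector; _∷_)

⟦_⟧ : Bool → ℚ
⟦ b ⟧ = if b then 1ℚ else 0ℚ

ℕ→ℚ : ℕ → ℚ
ℕ→ℚ n = Data.Integer.+ n Q./ 1

2^-_ : ℕ → ℚ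
2^- zero = 1ℚ
2^- suc k = ½ * (2^- k)

ΣFin : (n : ℕ) → (Fin n → ℚ) → ℚ
ΣFin zero    f = 0ℚ
ΣFin (suc n) f = f zero + ΣFin n (λ i → f (suc i))

ΣBits : (n : ℕ) → ((Fin n → Bool) → ℚ) → ℚ
ΣBits zero    f = f (λ ())
ΣBits (suc n) f = ΣBits n (λ t → f (false ∷ t)) + ΣBits n (λ t → f (true ∷ t))

-- The point set P_a(σ).  Bits are 0-indexed: index i ↔ paper's index i+1.
-- n = suc m, a ∈ {0,1}^{n-1} = Fin m → Bool, σ ∈ {0,1}^n = Fin (suc m) → Bool,
-- t = (t_1,…,t_n) : Fin (suc m) → Bool.

lastBit : (m : ℕ) → (Fin (suc m) → Bool) → Bool
lastBit m t = t (fromℕ m)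

bBit : (m : ℕ) → (Fin m → Bool) → (Fin (suc m) → Bool) →
       (Fin (suc m) → Bool) → Fin (suc m) → Bool
bBit m a σ t i with toℕ i ℕ.<? m
... | yes i<m = t i xor (a (fromℕ< i<m) ∧ lastBit m t) xor σ i
... | no _ = lastBit m t xor σ i

-- x-coordinate: t_n/2 + … + t_1/2^n, i.e. t_k has weight 2^{-(n+1-k)}
xCoord : (m : ℕ) → (Fin (suc m) → Bool) → ℚ
xCoord m t = ΣFin (suc m) (λ i → ⟦ t i ⟧ * 2^- (suc m ℕ.∸ toℕ i))

yCoord : (m : ℕ) → (Fin m → Bool) → (Fin (suc m) → Bool) →
         (Fin (suc m) → Bool) → ℚ
yCoord m a σ t = ΣFin (suc m) (λ i → ⟦ bBit m a σ t i ⟧ * 2^- (suc (toℕ i)))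

-- One–dimensional Haar functions: h_{-1,0} = 1_{[0,1)}, and h_{j,m}.
data HaarIdx : Set where
  h₋₁  : HaarIdx
  hjm  : (j m : ℕ) → HaarIdx

-- Lebesgue measure of [a,b) ∩ [z,1) for 0 ≤ a ≤ b ≤ 1, 0 ≤ z < 1
measFrom : ℚ → ℚ → ℚ → ℚ
measFrom z a b = 0ℚ ⊔ (b - (a ⊔ z))

-- ∫_0^1 t dt over [a,b) :  (b² - a²)/2
intId : ℚ → ℚ → ℚ
intId a b = ½ * (b * b - a * a)

left mid right : ℕ → ℕ → ℚ
left  j m = ℕ→ℚ m * 2^- j
mid   j m = ℕ→ℚ m * 2^- j + 2^- (suc j)
right j m = ℕ→ℚ (suc m) * 2^- j

-- ∫_0^1 1[z < t] h(t) dt  (= ∫_{[z,1)} h)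
intIndFrom : HaarIdx → ℚ → ℚ
intIndFrom h₋₁       z = measFrom z 0ℚ 1ℚ
intIndFrom (hjm j m) z = measFrom z (left j m) (mid j m) - measFrom z (mid j m) (right j m)

-- ∫_0^1 t h(t) dt
intT : HaarIdx → ℚ
intT h₋₁       = intId 0ℚ 1ℚ
intT (hjm j m) = intId (left j m) (mid j m) - intId (mid j m) (right j m)

-- Haar coefficient μ_{j,m} of Δ(·, P_a(σ)), n = suc m:
--   ∫∫ ( (1/N) Σ_z 1[z₁<t₁]1[z₂<t₂] - t₁t₂ ) h₁(t₁) h₂(t₂) dt
-- evaluated by linearity and Fubini (product of 1D integrals).
haarCoeff : (m : ℕ) → (Fin m → Bool) → (Fin (suc m) → Bool) →
            HaarIdx → HaarIdx → ℚ
haarCoeff m a σ h1 h2 =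
  2^- (suc m) * ΣBits (suc m) (λ t →
       intIndFrom h1 (xCoord m t) * intIndFrom h2 (yCoord m a σ t))
  - intT h1 * intT h2

-- 0-indexed bit lookup with default false out of range (only used in range)
bitAt : {n : ℕ} → (Fin n → Bool) → ℕ → Bool
bitAt {zero}  v i       = false
bitAt {suc n} v zero    = v zero
bitAt {suc n} v (suc i) = bitAt (λ k → v (suc k)) i

-- m₂ = Σ_{k=1}^{j} s_k 2^{j-k}  (s_k = s at 0-index k-1)
binNat : (j : ℕ) → (Fin j → Bool) → ℕ
binNat zero    s = 0
binNat (suc j) s = (if s zero then 2 ℕ.^ j else 0) ℕ.+ binNat j (λ i → s (suc i))

{-# OPTIONS --safe #-}
module Submission where

-- Split a point t = u ∷ʳ c off its last digit c = t_n.  Then x = x′(u) + c/2 with x′ linear in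
-- the digits of u, and y = 0.(u ⊕ τ_c) e_c is a digital shift of u.  The integral ∫_{[y,1)} h_{j,m}
-- vanishes unless the first j digits of y spell s, and is then 2^{-j} times the integral for h_{0,0}
-- at 2^j y - m.  Hence the first j digits of u are forced to u_i = s_i ⊕ τ_i; each forced digit
-- contributes a factor 1/4 and shifts x′ by its weight.  Averaging over the next digit turns
-- x′·∫_{[y,1)} h_{0,0} into an affine function of x′ and y (the products x′·y cancel), so only the
-- means of x′ and y over the remaining digits are needed.

open import Defs
open import Data.Bool using (Bool; true; false; not; _xor_; _∧_; if_then_else_)
open import Data.Bool.Properties
  using (∧-zeroʳ; ∧-identityʳ; xor-comm; xor-assoc; xor-same; xor-identityʳ; not-distribˡ-xor)
open import Data.Empty using (⊥-elim)
open import Data.Fin using (Fin; zero; suc; toℕ; inject₁; fromℕ; fromℕ<)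
import Data.Fin.Properties as FP
open import Data.Nat using (ℕ; zero; suc; _<_; _∸_; s≤s)
import Data.Nat as N
import Data.Nat.Properties as NP
open import Data.Nat.Coprimality using (1-coprimeTo) renaming (sym to coprime-sym)
open import Data.Nat.Tactic.RingSolver using (solve-∀)
import Data.Integer as ℤ
import Data.Integer.Properties as ℤP
open import Data.Product using (_×_; _,_; proj₁; proj₂; ∃-syntax)
open import Data.Rational using (ℚ; 0ℚ; 1ℚ; ½; _+_; _-_; _*_; -_; _≤_; _⊔_)
import Data.Rational as Q
import Data.Rational.Properties as QP
open import Data.Rational.Solver using (module +-*-Solver)
open +-*-Solver using (solve; _:+_; _:*_; _:-_; :-_; _:=_; con; Polynomial)
open import Data.Vec.Functional using (_∷_)
open import Relation.Binary.PropositionalEquality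
open import Relation.Nullary using (yes; no)

ℕ→ℚ-suc : ∀ n → ℕ→ℚ (suc n) ≡ 1ℚ + ℕ→ℚ n
ℕ→ℚ-suc n rewrite QP.normalize-coprime (coprime-sym (1-coprimeTo n)) =
  cong (λ z → (ℤ.+ 1 ℤ.+ z) Q./ 1) (sym (ℤP.*-identityʳ (ℤ.+ n)))

ℕ→ℚ-+ : ∀ m n → ℕ→ℚ (m N.+ n) ≡ ℕ→ℚ m + ℕ→ℚ n
ℕ→ℚ-+ zero    n = sym (QP.+-identityˡ (ℕ→ℚ n))
ℕ→ℚ-+ (suc m) n = begin
  ℕ→ℚ (suc (m N.+ n))   ≡⟨ ℕ→ℚ-suc (m N.+ n) ⟩
  1ℚ + ℕ→ℚ (m N.+ n)    ≡⟨ cong (1ℚ +_) (ℕ→ℚ-+ m n) ⟩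
  1ℚ + (ℕ→ℚ m + ℕ→ℚ n)  ≡⟨ QP.+-assoc 1ℚ (ℕ→ℚ m) (ℕ→ℚ n) ⟨
  1ℚ + ℕ→ℚ m + ℕ→ℚ n    ≡⟨ cong (_+ ℕ→ℚ n) (ℕ→ℚ-suc m) ⟨
  ℕ→ℚ (suc m) + ℕ→ℚ n   ∎
  where open ≡-Reasoning

ℕ→ℚ[2^n]*2^-n≡1 : ∀ n → ℕ→ℚ (2 N.^ n) * 2^- n ≡ 1ℚ
ℕ→ℚ[2^n]*2^-n≡1 zero    = refl
ℕ→ℚ[2^n]*2^-n≡1 (suc n) = begin
  ℕ→ℚ (2 N.^ n N.+ (2 N.^ n N.+ 0)) * (½ * 2^- n)
    ≡⟨ cong (λ k → ℕ→ℚ (2 N.^ n N.+ k) * (½ * 2^- n)) (NP.+-identityʳ (2 N.^ n)) ⟩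
  ℕ→ℚ (2 N.^ n N.+ 2 N.^ n) * (½ * 2^- n)
    ≡⟨ cong (_* (½ * 2^- n)) (ℕ→ℚ-+ (2 N.^ n) (2 N.^ n)) ⟩
  (x + x) * (½ * 2^- n)
    ≡⟨ solve 2 (λ x p → (x :+ x) :* (con ½ :* p) := x :* p) refl x (2^- n) ⟩
  x * 2^- n
    ≡⟨ ℕ→ℚ[2^n]*2^-n≡1 n ⟩
  1ℚ ∎
  where
  open ≡-Reasoning
  x : ℚ
  x = ℕ→ℚ (2 N.^ n)

2^-[m+n]≡2^-m*2^-n : ∀ m n → 2^- (m N.+ n) ≡ 2^- m * 2^- n
2^-[m+n]≡2^-m*2^-n zero    n = sym (QP.*-identityˡ (2^- n))
2^-[m+n]≡2^-m*2^-n (suc m) n =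
  trans (cong (½ *_) (2^-[m+n]≡2^-m*2^-n m n)) (sym (QP.*-assoc ½ (2^- m) (2^- n)))

2^-[a+b+c]≡2^-a*2^-b*2^-c : ∀ a b c → 2^- (a N.+ b N.+ c) ≡ 2^- a * 2^- b * 2^- c
2^-[a+b+c]≡2^-a*2^-b*2^-c a b c =
  trans (2^-[m+n]≡2^-m*2^-n (a N.+ b) c) (cong (_* 2^- c) (2^-[m+n]≡2^-m*2^-n a b))

½*-mono-≤ : ∀ {p q} → p ≤ q → ½ * p ≤ ½ * q
½*-mono-≤ = QP.*-monoˡ-≤-nonNeg ½

½*+½*-mono-≤ : ∀ {a a′ b b′} → a ≤ a′ → b ≤ b′ → ½ * a + ½ * b ≤ ½ * a′ + ½ * b′
½*+½*-mono-≤ a≤a′ b≤b′ = QP.+-mono-≤ (½*-mono-≤ a≤a′) (½*-mono-≤ b≤b′)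

½*+½*-monoʳ-≤ : ∀ c {b b′} → b ≤ b′ → ½ * c + ½ * b ≤ ½ * c + ½ * b′
½*+½*-monoʳ-≤ c b≤b′ = QP.+-monoʳ-≤ (½ * c) (½*-mono-≤ b≤b′)

0≤½* : ∀ {p} → 0ℚ ≤ p → 0ℚ ≤ ½ * p
0≤½* = ½*-mono-≤

p≤p+q : ∀ p {q} → 0ℚ ≤ q → p ≤ p + q
p≤p+q p {q} 0≤q = subst (_≤ p + q) (QP.+-identityʳ p) (QP.+-monoʳ-≤ p 0≤q)

0≤q-p : ∀ {p q} → p ≤ q → 0ℚ ≤ q - p
0≤q-p {p} {q} p≤q = subst (_≤ q - p) (QP.+-inverseʳ p) (QP.+-monoˡ-≤ (- p) p≤q)

p-q≤0 : ∀ {p q} → p ≤ q → p - q ≤ 0ℚ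
p-q≤0 {p} {q} p≤q = subst (p - q ≤_) (QP.+-inverseʳ q) (QP.+-monoˡ-≤ (- q) p≤q)

0≤2^-n : ∀ n → 0ℚ ≤ 2^- n
0≤2^-n zero    = QP.nonNegative⁻¹ 1ℚ
0≤2^-n (suc n) = 0≤½* (0≤2^-n n)

0≤⟦b⟧ : ∀ b → 0ℚ ≤ ⟦ b ⟧
0≤⟦b⟧ false = QP.≤-refl
0≤⟦b⟧ true  = QP.nonNegative⁻¹ 1ℚ

⟦b⟧≤1 : ∀ b → ⟦ b ⟧ ≤ 1ℚ
⟦b⟧≤1 false = QP.nonNegative⁻¹ 1ℚ
⟦b⟧≤1 true  = QP.≤-refl

0≤⟦b⟧*p : ∀ b {p} → 0ℚ ≤ p → 0ℚ ≤ ⟦ b ⟧ * p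
0≤⟦b⟧*p false {p} _   = QP.≤-reflexive (sym (QP.*-zeroˡ p))
0≤⟦b⟧*p true  {p} 0≤p = subst (0ℚ ≤_) (sym (QP.*-identityˡ p)) 0≤p

⟦b⟧*p≤p : ∀ b {p} → 0ℚ ≤ p → ⟦ b ⟧ * p ≤ p
⟦b⟧*p≤p false {p} 0≤p = subst (_≤ p) (sym (QP.*-zeroˡ p)) 0≤p
⟦b⟧*p≤p true  {p} _   = QP.≤-reflexive (QP.*-identityˡ p)

⟦not⟧≡1-⟦⟧ : ∀ b → ⟦ not b ⟧ ≡ 1ℚ - ⟦ b ⟧
⟦not⟧≡1-⟦⟧ false = refl
⟦not⟧≡1-⟦⟧ true  = refl

xor-cancelʳ : ∀ x y → (x xor y) xor y ≡ x
xor-cancelʳ x y = trans (xor-assoc x y y) (trans (cong (x xor_) (xor-same y)) (xor-identityʳ x))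

ΣFin-cong : ∀ n {f g : Fin n → ℚ} → (∀ i → f i ≡ g i) → ΣFin n f ≡ ΣFin n g
ΣFin-cong zero    f≗g = refl
ΣFin-cong (suc n) f≗g = cong₂ _+_ (f≗g zero) (ΣFin-cong n (λ i → f≗g (suc i)))

ΣFin-+ : ∀ n (f g : Fin n → ℚ) → ΣFin n (λ i → f i + g i) ≡ ΣFin n f + ΣFin n g
ΣFin-+ zero    f g = refl
ΣFin-+ (suc n) f g =
  trans (cong (f zero + g zero +_) (ΣFin-+ n (λ i → f (suc i)) (λ i → g (suc i))))
        (solve 4 (λ a b c d → a :+ b :+ (c :+ d) := a :+ c :+ (b :+ d)) refl
               (f zero) (g zero) (ΣFin n (λ i → f (suc i))) (ΣFin n (λ i → g (suc i))))

ΣFin-* : ∀ n c (f : Fin n → ℚ) → ΣFin n (λ i → c * f i) ≡ c * ΣFin n f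
ΣFin-* zero    c f = sym (QP.*-zeroʳ c)
ΣFin-* (suc n) c f =
  trans (cong (c * f zero +_) (ΣFin-* n c (λ i → f (suc i))))
        (sym (QP.*-distribˡ-+ c (f zero) (ΣFin n (λ i → f (suc i)))))

ΣFin-init-last : ∀ m (f : Fin (suc m) → ℚ) →
  ΣFin (suc m) f ≡ ΣFin m (λ k → f (inject₁ k)) + f (fromℕ m)
ΣFin-init-last zero    f = trans (QP.+-identityʳ (f zero)) (sym (QP.+-identityˡ (f zero)))
ΣFin-init-last (suc m) f =
  trans (cong (f zero +_) (ΣFin-init-last m (λ i → f (suc i))))
        (sym (QP.+-assoc (f zero) (ΣFin m (λ k → f (suc (inject₁ k)))) (f (suc (fromℕ m)))))

-- Recursive in m, so that (b ∷ u) ∷ʳ c reduces to b ∷ (u ∷ʳ c).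
infixl 5 _∷ʳ_
_∷ʳ_ : ∀ {A : Set} {m} → (Fin m → A) → A → Fin (suc m) → A
_∷ʳ_ {m = zero}  u c = c ∷ u
_∷ʳ_ {m = suc m} u c = u zero ∷ ((λ i → u (suc i)) ∷ʳ c)

∷ʳ-inject₁ : ∀ {A : Set} {m} (u : Fin m → A) c k → (u ∷ʳ c) (inject₁ k) ≡ u k
∷ʳ-inject₁ {m = suc m} u c zero    = refl
∷ʳ-inject₁ {m = suc m} u c (suc k) = ∷ʳ-inject₁ (λ i → u (suc i)) c k

∷ʳ-fromℕ : ∀ {A : Set} {m} (u : Fin m → A) c → (u ∷ʳ c) (fromℕ m) ≡ c
∷ʳ-fromℕ {m = zero}  u c = refl
∷ʳ-fromℕ {m = suc m} u c = ∷ʳ-fromℕ (λ i → u (suc i)) c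

ΣBits-cong : ∀ n {f g : (Fin n → Bool) → ℚ} → (∀ t → f t ≡ g t) → ΣBits n f ≡ ΣBits n g
ΣBits-cong zero    f≗g = f≗g _
ΣBits-cong (suc n) f≗g =
  cong₂ _+_ (ΣBits-cong n (λ t → f≗g (false ∷ t))) (ΣBits-cong n (λ t → f≗g (true ∷ t)))

ΣBits-+ : ∀ n f g → ΣBits n (λ t → f t + g t) ≡ ΣBits n f + ΣBits n g
ΣBits-+ zero    f g = refl
ΣBits-+ (suc n) f g =
  trans (cong₂ _+_ (ΣBits-+ n (λ t → f (false ∷ t)) (λ t → g (false ∷ t)))
                   (ΣBits-+ n (λ t → f (true ∷ t)) (λ t → g (true ∷ t))))
        (solve 4 (λ a b c d → a :+ b :+ (c :+ d) := a :+ c :+ (b :+ d)) refl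
               (ΣBits n (λ t → f (false ∷ t))) (ΣBits n (λ t → g (false ∷ t)))
               (ΣBits n (λ t → f (true ∷ t))) (ΣBits n (λ t → g (true ∷ t))))

ΣBits-* : ∀ n c f → ΣBits n (λ t → c * f t) ≡ c * ΣBits n f
ΣBits-* zero    c f = refl
ΣBits-* (suc n) c f =
  trans (cong₂ _+_ (ΣBits-* n c (λ t → f (false ∷ t))) (ΣBits-* n c (λ t → f (true ∷ t))))
        (sym (QP.*-distribˡ-+ c (ΣBits n (λ t → f (false ∷ t))) (ΣBits n (λ t → f (true ∷ t)))))

mean : (n : ℕ) → ((Fin n → Bool) → ℚ) → ℚ
mean n f = 2^- n * ΣBits n f

mean-cong : ∀ n {f g : (Fin n → Bool) → ℚ} → (∀ t → f t ≡ g t) → mean n f ≡ mean n g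
mean-cong n f≗g = cong (2^- n *_) (ΣBits-cong n f≗g)

mean-+ : ∀ n f g → mean n (λ t → f t + g t) ≡ mean n f + mean n g
mean-+ n f g = trans (cong (2^- n *_) (ΣBits-+ n f g)) (QP.*-distribˡ-+ (2^- n) (ΣBits n f) (ΣBits n g))

mean-* : ∀ n c f → mean n (λ t → c * f t) ≡ c * mean n f
mean-* n c f =
  trans (cong (2^- n *_) (ΣBits-* n c f))
        (solve 3 (λ p c s → p :* (c :* s) := c :* (p :* s)) refl (2^- n) c (ΣBits n f))

mean-∷ : ∀ n f → mean (suc n) f ≡ ½ * (mean n (λ t → f (false ∷ t)) + mean n (λ t → f (true ∷ t)))
mean-∷ n f =
  trans (QP.*-assoc ½ (2^- n) _)
        (cong (½ *_) (QP.*-distribˡ-+ (2^- n) (ΣBits n (λ t → f (false ∷ t)))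
                                              (ΣBits n (λ t → f (true ∷ t)))))

mean-const : ∀ n c → mean n (λ _ → c) ≡ c
mean-const zero    c = QP.*-identityˡ c
mean-const (suc n) c =
  trans (mean-∷ n (λ _ → c))
        (trans (cong (λ x → ½ * (x + x)) (mean-const n c)) (solve 1 (λ c → con ½ :* (c :+ c) := c) refl c))

mean-+-const : ∀ n c f → mean n (λ t → c + f t) ≡ c + mean n f
mean-+-const n c f = trans (mean-+ n (λ _ → c) f) (cong (_+ mean n f) (mean-const n c))

mean-linear : ∀ n α β γ f g →
  mean n (λ t → α + β * f t + γ * g t) ≡ α + β * mean n f + γ * mean n g
mean-linear n α β γ f g = begin
  mean n (λ t → α + β * f t + γ * g t)
    ≡⟨ mean-+ n (λ t → α + β * f t) (λ t → γ * g t) ⟩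
  mean n (λ t → α + β * f t) + mean n (λ t → γ * g t)
    ≡⟨ cong₂ _+_ (mean-+-const n α (λ t → β * f t)) (mean-* n γ g) ⟩
  α + mean n (λ t → β * f t) + γ * mean n g
    ≡⟨ cong (λ x → α + x + γ * mean n g) (mean-* n β f) ⟩
  α + β * mean n f + γ * mean n g ∎
  where open ≡-Reasoning

mean-∷-+ : ∀ n (h : Bool → ℚ) g →
  mean (suc n) (λ t → h (t zero) + g (λ i → t (suc i))) ≡ ½ * (h false + h true) + mean n g
mean-∷-+ n h g = begin
  mean (suc n) (λ t → h (t zero) + g (λ i → t (suc i)))
    ≡⟨ mean-∷ n (λ t → h (t zero) + g (λ i → t (suc i))) ⟩
  ½ * (mean n (λ t → h false + g t) + mean n (λ t → h true + g t))
    ≡⟨ cong₂ (λ x y → ½ * (x + y)) (mean-+-const n (h false) g) (mean-+-const n (h true) g) ⟩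
  ½ * (h false + mean n g + (h true + mean n g))
    ≡⟨ solve 3 (λ a b m → con ½ :* (a :+ m :+ (b :+ m)) := con ½ :* (a :+ b) :+ m)
             refl (h false) (h true) (mean n g) ⟩
  ½ * (h false + h true) + mean n g ∎
  where open ≡-Reasoning

mean-∷ʳ : ∀ n f →
  mean (suc n) f ≡ ½ * (mean n (λ u → f (u ∷ʳ false)) + mean n (λ u → f (u ∷ʳ true)))
mean-∷ʳ zero    f = mean-∷ zero f
mean-∷ʳ (suc n) f = begin
  mean (suc (suc n)) f
    ≡⟨ mean-∷ (suc n) f ⟩
  ½ * (mean (suc n) (λ t → f (false ∷ t)) + mean (suc n) (λ t → f (true ∷ t)))
    ≡⟨ cong₂ (λ x y → ½ * (x + y)) (mean-∷ʳ n (λ t → f (false ∷ t)))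
                                   (mean-∷ʳ n (λ t → f (true ∷ t))) ⟩
  ½ * (½ * (M false false + M false true) + ½ * (M true false + M true true))
    ≡⟨ solve 4 (λ a b c d → con ½ :* (con ½ :* (a :+ b) :+ con ½ :* (c :+ d))
                          := con ½ :* (con ½ :* (a :+ c) :+ con ½ :* (b :+ d)))
             refl (M false false) (M false true) (M true false) (M true true) ⟩
  ½ * (½ * (M false false + M true false) + ½ * (M false true + M true true))
    ≡⟨ cong₂ (λ x y → ½ * (x + y)) (mean-∷ n (λ u → f (u ∷ʳ false)))
                                   (mean-∷ n (λ u → f (u ∷ʳ true))) ⟨
  ½ * (mean (suc n) (λ u → f (u ∷ʳ false)) + mean (suc n) (λ u → f (u ∷ʳ true))) ∎
  where
  open ≡-Reasoning
  M : Bool → Bool → ℚ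
  M b c = mean n (λ u → f (b ∷ (u ∷ʳ c)))

sum-Bool-at : ∀ (g : Bool → ℚ) b → g (not b) ≡ 0ℚ → g false + g true ≡ g b
sum-Bool-at g false g[true]≡0  = trans (cong (g false +_) g[true]≡0) (QP.+-identityʳ (g false))
sum-Bool-at g true  g[false]≡0 = trans (cong (_+ g true) g[false]≡0) (QP.+-identityˡ (g true))

mean-∷-pair : ∀ n f → mean (suc n) f ≡ ½ * mean n (λ t → f (false ∷ t) + f (true ∷ t))
mean-∷-pair n f =
  trans (mean-∷ n f) (cong (½ *_) (sym (mean-+ n (λ t → f (false ∷ t)) (λ t → f (true ∷ t)))))

mean-∷-at : ∀ n f b → (∀ t → f (not b ∷ t) ≡ 0ℚ) → mean (suc n) f ≡ ½ * mean n (λ t → f (b ∷ t))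
mean-∷-at n f b f[not-b]≡0 =
  trans (mean-∷-pair n f) (cong (½ *_) (mean-cong n (λ t → sum-Bool-at (λ c → f (c ∷ t)) b (f[not-b]≡0 t))))

measFrom-after : ∀ a {z b} → b ≤ z → measFrom z a b ≡ 0ℚ
measFrom-after a {z} {b} b≤z = QP.p≥q⇒p⊔q≡p (p-q≤0 (QP.≤-trans b≤z (QP.p≤q⊔p a z)))

measFrom-before : ∀ {z a b} → z ≤ a → a ≤ b → measFrom z a b ≡ b - a
measFrom-before {z} {a} {b} z≤a a≤b rewrite QP.p≥q⇒p⊔q≡p z≤a = QP.p≤q⇒p⊔q≡q (0≤q-p a≤b)

measFrom-inside : ∀ {z a b} → a ≤ z → z ≤ b → measFrom z a b ≡ b - z
measFrom-inside {z} {a} {b} a≤z z≤b rewrite QP.p≤q⇒p⊔q≡q a≤z = QP.p≤q⇒p⊔q≡q (0≤q-p z≤b)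

measFrom-affine : ∀ c z a b → measFrom (c + ½ * z) (c + ½ * a) (c + ½ * b) ≡ ½ * measFrom z a b
measFrom-affine c z a b = begin
  0ℚ ⊔ ((c + ½ * b) - ((c + ½ * a) ⊔ (c + ½ * z)))
    ≡⟨ cong (λ w → 0ℚ ⊔ ((c + ½ * b) - w))
            (QP.mono-≤-distrib-⊔ {λ x → c + ½ * x} (λ h → QP.+-monoʳ-≤ c (½*-mono-≤ h)) a z) ⟨
  0ℚ ⊔ ((c + ½ * b) - (c + ½ * (a ⊔ z)))
    ≡⟨ cong (0ℚ ⊔_) (solve 3 (λ c b w → (c :+ con ½ :* b) :- (c :+ con ½ :* w) := con ½ :* (b :- w))
                             refl c b (a ⊔ z)) ⟩
  (½ * 0ℚ) ⊔ (½ * (b - (a ⊔ z)))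
    ≡⟨ QP.mono-≤-distrib-⊔ {½ *_} ½*-mono-≤ 0ℚ (b - (a ⊔ z)) ⟨
  ½ * measFrom z a b ∎
  where open ≡-Reasoning

-- ∫_{[z,1)} h for the Haar function h = 1 on [ℓ, ℓ + w/2) and h = -1 on [ℓ + w/2, ℓ + w).
haarFrom : ℚ → ℚ → ℚ → ℚ
haarFrom ℓ w z = measFrom z ℓ (ℓ + ½ * w) - measFrom z (ℓ + ½ * w) (ℓ + w)

module _ (ℓ : ℚ) {w : ℚ} (0≤w : 0ℚ ≤ w) where

  private
    ℓ≤mid : ℓ ≤ ℓ + ½ * w
    ℓ≤mid = p≤p+q ℓ (0≤½* 0≤w)

    mid≤r : ℓ + ½ * w ≤ ℓ + w
    mid≤r = subst (ℓ + ½ * w ≤_)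
                  (solve 2 (λ ℓ w → ℓ :+ con ½ :* w :+ con ½ :* w := ℓ :+ w) refl ℓ w)
                  (p≤p+q (ℓ + ½ * w) (0≤½* 0≤w))

  haarFrom-below : ∀ {z} → z ≤ ℓ → haarFrom ℓ w z ≡ 0ℚ
  haarFrom-below z≤ℓ =
    trans (cong₂ _-_ (measFrom-before z≤ℓ ℓ≤mid) (measFrom-before (QP.≤-trans z≤ℓ ℓ≤mid) mid≤r))
          (solve 2 (λ ℓ w → (ℓ :+ con ½ :* w :- ℓ) :- (ℓ :+ w :- (ℓ :+ con ½ :* w)) := con 0ℚ)
                   refl ℓ w)

  haarFrom-above : ∀ {z} → ℓ + w ≤ z → haarFrom ℓ w z ≡ 0ℚ
  haarFrom-above r≤z =
    cong₂ _-_ (measFrom-after ℓ (QP.≤-trans mid≤r r≤z)) (measFrom-after (ℓ + ½ * w) r≤z)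

  haarFrom-firstHalf : ∀ {z} → ℓ ≤ z → z ≤ ℓ + ½ * w → haarFrom ℓ w z ≡ ℓ - z
  haarFrom-firstHalf {z} ℓ≤z z≤mid =
    trans (cong₂ _-_ (measFrom-inside ℓ≤z z≤mid) (measFrom-before z≤mid mid≤r))
          (solve 3 (λ ℓ w z → (ℓ :+ con ½ :* w :- z) :- (ℓ :+ w :- (ℓ :+ con ½ :* w)) := ℓ :- z)
                   refl ℓ w z)

  haarFrom-secondHalf : ∀ {z} → ℓ + ½ * w ≤ z → z ≤ ℓ + w → haarFrom ℓ w z ≡ z - (ℓ + w)
  haarFrom-secondHalf {z} mid≤z z≤r =
    trans (cong₂ _-_ (measFrom-after ℓ mid≤z) (measFrom-inside mid≤z z≤r))
          (solve 2 (λ r z → con 0ℚ :- (r :- z) := z :- r) refl (ℓ + w) z)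

haarFrom-zoom : ∀ c ℓ w z → haarFrom (c + ½ * ℓ) (½ * w) (c + ½ * z) ≡ ½ * haarFrom ℓ w z
haarFrom-zoom c ℓ w z = begin
  measFrom z′ (c + ½ * ℓ) (c + ½ * ℓ + ½ * (½ * w))
    - measFrom z′ (c + ½ * ℓ + ½ * (½ * w)) (c + ½ * ℓ + ½ * w)
    ≡⟨ cong₂ (λ m r → measFrom z′ (c + ½ * ℓ) m - measFrom z′ m r)
             (solve 3 (λ c ℓ w → c :+ con ½ :* ℓ :+ con ½ :* (con ½ :* w) := c :+ con ½ :* (ℓ :+ con ½ :* w))
                    refl c ℓ w)
             (solve 3 (λ c ℓ w → c :+ con ½ :* ℓ :+ con ½ :* w := c :+ con ½ :* (ℓ :+ w)) refl c ℓ w) ⟩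
  measFrom z′ (c + ½ * ℓ) (c + ½ * (ℓ + ½ * w))
    - measFrom z′ (c + ½ * (ℓ + ½ * w)) (c + ½ * (ℓ + w))
    ≡⟨ cong₂ _-_ (measFrom-affine c z ℓ (ℓ + ½ * w)) (measFrom-affine c z (ℓ + ½ * w) (ℓ + w)) ⟩
  ½ * measFrom z ℓ (ℓ + ½ * w) - ½ * measFrom z (ℓ + ½ * w) (ℓ + w)
    ≡⟨ solve 2 (λ a b → con ½ :* a :- con ½ :* b := con ½ :* (a :- b)) refl
             (measFrom z ℓ (ℓ + ½ * w)) (measFrom z (ℓ + ½ * w) (ℓ + w)) ⟩
  ½ * haarFrom ℓ w z ∎
  where
  open ≡-Reasoning
  z′ : ℚ
  z′ = c + ½ * z

-- The chains below rely on ½ * ⟦ false ⟧ + ½ * 1ℚ and ½ * ⟦ true ⟧ + ½ * 0ℚ being the same closed term.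
haarFrom-otherChild : ∀ b {ℓ w y} → 0ℚ ≤ ℓ → ℓ + w ≤ 1ℚ → 0ℚ ≤ w → 0ℚ ≤ y → y ≤ 1ℚ →
  haarFrom (½ * ⟦ b ⟧ + ½ * ℓ) (½ * w) (½ * ⟦ not b ⟧ + ½ * y) ≡ 0ℚ
haarFrom-otherChild false {ℓ} {w} {y} _ ℓ+w≤1 0≤w 0≤y _ =
  haarFrom-above (½ * ⟦ false ⟧ + ½ * ℓ) (0≤½* 0≤w) (begin
  ½ * ⟦ false ⟧ + ½ * ℓ + ½ * w  ≡⟨ solve 3 (λ c ℓ w → c :+ con ½ :* ℓ :+ con ½ :* w := c :+ con ½ :* (ℓ :+ w))
                                           refl (½ * ⟦ false ⟧) ℓ w ⟩
  ½ * ⟦ false ⟧ + ½ * (ℓ + w)    ≤⟨ ½*+½*-monoʳ-≤ ⟦ false ⟧ ℓ+w≤1 ⟩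
  ½ * ⟦ true ⟧ + ½ * 0ℚ          ≤⟨ ½*+½*-monoʳ-≤ ⟦ true ⟧ 0≤y ⟩
  ½ * ⟦ true ⟧ + ½ * y           ∎)
  where open QP.≤-Reasoning
haarFrom-otherChild true {ℓ} {w} {y} 0≤ℓ _ 0≤w _ y≤1 =
  haarFrom-below (½ * ⟦ true ⟧ + ½ * ℓ) (0≤½* 0≤w) (begin
  ½ * ⟦ false ⟧ + ½ * y   ≤⟨ ½*+½*-monoʳ-≤ ⟦ false ⟧ y≤1 ⟩
  ½ * ⟦ true ⟧ + ½ * 0ℚ   ≤⟨ ½*+½*-monoʳ-≤ ⟦ true ⟧ 0≤ℓ ⟩
  ½ * ⟦ true ⟧ + ½ * ℓ    ∎)
  where open QP.≤-Reasoning

haarFrom-unit : ∀ d {y} → 0ℚ ≤ y → y ≤ 1ℚ →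
  haarFrom 0ℚ 1ℚ (½ * ⟦ d ⟧ + ½ * y) ≡ ⟦ d ⟧ * (y - ½) - ½ * y
haarFrom-unit false {y} 0≤y y≤1 =
  trans (haarFrom-firstHalf 0ℚ (0≤⟦b⟧ true) (½*+½*-monoʳ-≤ ⟦ false ⟧ 0≤y) (½*+½*-monoʳ-≤ ⟦ false ⟧ y≤1))
        (solve 1 (λ y → con 0ℚ :- (con ½ :* con 0ℚ :+ con ½ :* y) := con 0ℚ :* (y :- con ½) :- con ½ :* y)
               refl y)
haarFrom-unit true {y} 0≤y y≤1 =
  trans (haarFrom-secondHalf 0ℚ (0≤⟦b⟧ true) (½*+½*-monoʳ-≤ ⟦ true ⟧ 0≤y) (½*+½*-monoʳ-≤ ⟦ true ⟧ y≤1))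
        (solve 1 (λ y → con ½ :* con 1ℚ :+ con ½ :* y :- (con 0ℚ :+ con 1ℚ) := con 1ℚ :* (y :- con ½) :- con ½ :* y)
               refl y)

-- The two values of the next digit give opposite coefficients of y, so the products x·y cancel.
haarFrom-unit-pair : ∀ t A q x {y} → 0ℚ ≤ y → y ≤ 1ℚ →
  (A - (⟦ false ⟧ * q + x)) * haarFrom 0ℚ 1ℚ (½ * ⟦ t ⟧ + ½ * y)
    + (A - (⟦ true ⟧ * q + x)) * haarFrom 0ℚ 1ℚ (½ * ⟦ not t ⟧ + ½ * y)
  ≡ ½ * q * (1ℚ - ⟦ t ⟧) - ½ * A + ½ * x + q * (⟦ t ⟧ - ½) * y
haarFrom-unit-pair t A q x {y} 0≤y y≤1 = begin
  (A - (⟦ false ⟧ * q + x)) * haarFrom 0ℚ 1ℚ (½ * ⟦ t ⟧ + ½ * y)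
    + (A - (⟦ true ⟧ * q + x)) * haarFrom 0ℚ 1ℚ (½ * ⟦ not t ⟧ + ½ * y)
    ≡⟨ cong₂ (λ h₀ h₁ → (A - (⟦ false ⟧ * q + x)) * h₀ + (A - (⟦ true ⟧ * q + x)) * h₁)
             (haarFrom-unit t 0≤y y≤1) (haarFrom-unit (not t) 0≤y y≤1) ⟩
  (A - (⟦ false ⟧ * q + x)) * (⟦ t ⟧ * (y - ½) - ½ * y)
    + (A - (⟦ true ⟧ * q + x)) * (⟦ not t ⟧ * (y - ½) - ½ * y)
    ≡⟨ cong (λ t′ → (A - (⟦ false ⟧ * q + x)) * (⟦ t ⟧ * (y - ½) - ½ * y)
                    + (A - (⟦ true ⟧ * q + x)) * (t′ * (y - ½) - ½ * y))
            (⟦not⟧≡1-⟦⟧ t) ⟩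
  (A - (⟦ false ⟧ * q + x)) * (⟦ t ⟧ * (y - ½) - ½ * y)
    + (A - (⟦ true ⟧ * q + x)) * ((1ℚ - ⟦ t ⟧) * (y - ½) - ½ * y)
    ≡⟨ solve 5 (λ A q x y t →
         (A :- (con 0ℚ :* q :+ x)) :* (t :* (y :- con ½) :- con ½ :* y)
           :+ (A :- (con 1ℚ :* q :+ x)) :* ((con 1ℚ :- t) :* (y :- con ½) :- con ½ :* y)
         := con ½ :* q :* (con 1ℚ :- t) :- con ½ :* A :+ con ½ :* x :+ q :* (t :- con ½) :* y)
         refl A q x y ⟦ t ⟧ ⟩
  ½ * q * (1ℚ - ⟦ t ⟧) - ½ * A + ½ * x + q * (⟦ t ⟧ - ½) * y ∎
  where open ≡-Reasoning

digits : (n : ℕ) → (Fin n → Bool) → ℚ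
digits zero    b = 0ℚ
digits (suc n) b = ½ * ⟦ b zero ⟧ + ½ * digits n (λ i → b (suc i))

digits-bounds : ∀ n b → 0ℚ ≤ digits n b × digits n b + 2^- n ≤ 1ℚ
digits-bounds zero    b = QP.≤-refl , QP.≤-refl
digits-bounds (suc n) b with digits-bounds n (λ i → b (suc i))
... | 0≤d , d+2^-n≤1 = ½*+½*-mono-≤ (0≤⟦b⟧ (b zero)) 0≤d , (begin
  ½ * ⟦ b zero ⟧ + ½ * d + ½ * 2^- n  ≡⟨ solve 3 (λ c d p → c :+ con ½ :* d :+ con ½ :* p := c :+ con ½ :* (d :+ p))
                                                refl (½ * ⟦ b zero ⟧) d (2^- n) ⟩
  ½ * ⟦ b zero ⟧ + ½ * (d + 2^- n)    ≤⟨ ½*+½*-mono-≤ (⟦b⟧≤1 (b zero)) d+2^-n≤1 ⟩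
  ½ * 1ℚ + ½ * 1ℚ                     ∎)
  where
  open QP.≤-Reasoning
  d : ℚ
  d = digits n (λ i → b (suc i))

0≤digits : ∀ n b → 0ℚ ≤ digits n b
0≤digits n b = proj₁ (digits-bounds n b)

digits≤1 : ∀ n b → digits n b ≤ 1ℚ
digits≤1 n b = QP.≤-trans (p≤p+q (digits n b) (0≤2^-n n)) (proj₂ (digits-bounds n b))

haarFrom-digits-otherChild : ∀ j s {y} → 0ℚ ≤ y → y ≤ 1ℚ →
  haarFrom (digits (suc j) s) (2^- (suc j)) (½ * ⟦ not (s zero) ⟧ + ½ * y) ≡ 0ℚ
haarFrom-digits-otherChild j s 0≤y y≤1 =
  haarFrom-otherChild (s zero) (0≤digits j s′) (proj₂ (digits-bounds j s′)) (0≤2^-n j) 0≤y y≤1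
  where
  s′ : Fin j → Bool
  s′ i = s (suc i)

ΣFin≡digits : ∀ n b → ΣFin n (λ i → ⟦ b i ⟧ * 2^- (suc (toℕ i))) ≡ digits n b
ΣFin≡digits zero    b = refl
ΣFin≡digits (suc n) b = cong₂ _+_ (QP.*-comm ⟦ b zero ⟧ ½) (begin
  ΣFin n (λ i → ⟦ b (suc i) ⟧ * (½ * 2^- (suc (toℕ i))))
    ≡⟨ ΣFin-cong n (λ i → solve 3 (λ a h p → a :* (h :* p) := h :* (a :* p))
                                  refl ⟦ b (suc i) ⟧ ½ (2^- (suc (toℕ i)))) ⟩
  ΣFin n (λ i → ½ * (⟦ b (suc i) ⟧ * 2^- (suc (toℕ i))))
    ≡⟨ ΣFin-* n ½ (λ i → ⟦ b (suc i) ⟧ * 2^- (suc (toℕ i))) ⟩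
  ½ * ΣFin n (λ i → ⟦ b (suc i) ⟧ * 2^- (suc (toℕ i)))
    ≡⟨ cong (½ *_) (ΣFin≡digits n (λ i → b (suc i))) ⟩
  ½ * digits n (λ i → b (suc i)) ∎)
  where open ≡-Reasoning

xInit : (m : ℕ) → (Fin m → Bool) → ℚ
xInit m u = ΣFin m (λ k → ⟦ u k ⟧ * 2^- (suc m ∸ toℕ k))

xInit-bounds : ∀ m u → 0ℚ ≤ xInit m u × xInit m u + 2^- (suc m) ≤ ½
xInit-bounds zero    u = QP.≤-refl , QP.≤-refl
xInit-bounds (suc m) u with xInit-bounds m (λ i → u (suc i))
... | 0≤x , x+2^-m-1≤½ = QP.+-mono-≤ (0≤⟦b⟧*p (u zero) (0≤2^-n (suc (suc m)))) 0≤x , (begin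
  ⟦ u zero ⟧ * q + x + q  ≤⟨ QP.+-monoˡ-≤ q (QP.+-monoˡ-≤ x (⟦b⟧*p≤p (u zero) (0≤2^-n (suc (suc m))))) ⟩
  q + x + q               ≡⟨ solve 2 (λ p x → con ½ :* (con ½ :* p) :+ x :+ con ½ :* (con ½ :* p) := x :+ con ½ :* p)
                                   refl (2^- m) x ⟩
  x + 2^- (suc m)         ≤⟨ x+2^-m-1≤½ ⟩
  ½                       ∎)
  where
  open QP.≤-Reasoning
  q x : ℚ
  q = 2^- (suc (suc m))
  x = xInit m (λ i → u (suc i))

xCoord-∷ʳ : ∀ m u c → xCoord m (u ∷ʳ c) ≡ xInit m u + ⟦ c ⟧ * ½
xCoord-∷ʳ m u c = begin
  xCoord m (u ∷ʳ c)
    ≡⟨ ΣFin-init-last m (λ i → ⟦ (u ∷ʳ c) i ⟧ * 2^- (suc m ∸ toℕ i)) ⟩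
  ΣFin m (λ k → ⟦ (u ∷ʳ c) (inject₁ k) ⟧ * 2^- (suc m ∸ toℕ (inject₁ k)))
    + ⟦ (u ∷ʳ c) (fromℕ m) ⟧ * 2^- (suc m ∸ toℕ (fromℕ m))
    ≡⟨ cong₂ _+_ (ΣFin-cong m (λ k → cong₂ (λ b i → ⟦ b ⟧ * 2^- (suc m ∸ i))
                                          (∷ʳ-inject₁ u c k) (FP.toℕ-inject₁ k)))
                 (cong₂ (λ b i → ⟦ b ⟧ * 2^- (suc m ∸ i)) (∷ʳ-fromℕ u c) (FP.toℕ-fromℕ m)) ⟩
  xInit m u + ⟦ c ⟧ * 2^- (suc m ∸ m)
    ≡⟨ cong (λ k → xInit m u + ⟦ c ⟧ * 2^- k) (NP.m+n∸n≡m 1 m) ⟩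
  xInit m u + ⟦ c ⟧ * ½ ∎
  where open ≡-Reasoning

xCoord-∷ʳ-bounds : ∀ m u c → 0ℚ ≤ xInit m u + ⟦ c ⟧ * ½ × xInit m u + ⟦ c ⟧ * ½ ≤ 1ℚ
xCoord-∷ʳ-bounds m u c with xInit-bounds m u
... | 0≤x , x+2^-m-1≤½ =
  QP.+-mono-≤ 0≤x (0≤⟦b⟧*p c (0≤2^-n 1)) ,
  QP.+-mono-≤ (QP.≤-trans (p≤p+q (xInit m u) (0≤2^-n (suc m))) x+2^-m-1≤½) (⟦b⟧*p≤p c (0≤2^-n 1))

digitShift : (m : ℕ) → (Fin m → Bool) → (Fin (suc m) → Bool) → Bool → Fin m → Bool
digitShift m a σ c k = (a k ∧ c) xor σ (inject₁ k)

shiftedDigits : (m : ℕ) → (Fin m → Bool) → Bool → (Fin m → Bool) → ℚ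
shiftedDigits m τ e u = digits (suc m) ((λ k → u k xor τ k) ∷ʳ e)

bBit-inject₁ : ∀ m a σ u c k → bBit m a σ (u ∷ʳ c) (inject₁ k) ≡ u k xor digitShift m a σ c k
bBit-inject₁ m a σ u c k with toℕ (inject₁ k) N.<? m
... | yes k<m = trans
  (cong₂ (λ x y → x xor (a (fromℕ< k<m) ∧ y) xor σ (inject₁ k)) (∷ʳ-inject₁ u c k) (∷ʳ-fromℕ u c))
  (cong (λ i → u k xor (a i ∧ c) xor σ (inject₁ k))
        (FP.toℕ-injective (trans (FP.toℕ-fromℕ< k<m) (FP.toℕ-inject₁ k))))
... | no k≮m = ⊥-elim (k≮m (FP.inject₁ℕ< k))

bBit-fromℕ : ∀ m a σ u c → bBit m a σ (u ∷ʳ c) (fromℕ m) ≡ c xor σ (fromℕ m)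
bBit-fromℕ m a σ u c with toℕ (fromℕ m) N.<? m
... | yes m<m = ⊥-elim (NP.<-irrefl (FP.toℕ-fromℕ m) m<m)
... | no _    = cong (_xor σ (fromℕ m)) (∷ʳ-fromℕ u c)

yCoord-∷ʳ : ∀ m a σ u c →
  yCoord m a σ (u ∷ʳ c) ≡ shiftedDigits m (digitShift m a σ c) (c xor σ (fromℕ m)) u
yCoord-∷ʳ m a σ u c = begin
  yCoord m a σ (u ∷ʳ c)
    ≡⟨ ΣFin-init-last m (λ i → ⟦ bBit m a σ (u ∷ʳ c) i ⟧ * 2^- (suc (toℕ i))) ⟩
  ΣFin m (λ k → ⟦ bBit m a σ (u ∷ʳ c) (inject₁ k) ⟧ * 2^- (suc (toℕ (inject₁ k))))
    + ⟦ bBit m a σ (u ∷ʳ c) (fromℕ m) ⟧ * 2^- (suc (toℕ (fromℕ m)))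
    ≡⟨ cong₂ _+_ (ΣFin-cong m (λ k → cong (λ b → ⟦ b ⟧ * 2^- (suc (toℕ (inject₁ k))))
                                          (trans (bBit-inject₁ m a σ u c k) (sym (∷ʳ-inject₁ v e k)))))
                 (cong (λ b → ⟦ b ⟧ * 2^- (suc (toℕ (fromℕ m))))
                       (trans (bBit-fromℕ m a σ u c) (sym (∷ʳ-fromℕ v e)))) ⟩
  ΣFin m (λ k → ⟦ (v ∷ʳ e) (inject₁ k) ⟧ * 2^- (suc (toℕ (inject₁ k))))
    + ⟦ (v ∷ʳ e) (fromℕ m) ⟧ * 2^- (suc (toℕ (fromℕ m)))
    ≡⟨ ΣFin-init-last m (λ i → ⟦ (v ∷ʳ e) i ⟧ * 2^- (suc (toℕ i))) ⟨
  ΣFin (suc m) (λ i → ⟦ (v ∷ʳ e) i ⟧ * 2^- (suc (toℕ i)))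
    ≡⟨ ΣFin≡digits (suc m) (v ∷ʳ e) ⟩
  shiftedDigits m (digitShift m a σ c) e u ∎
  where
  open ≡-Reasoning
  v : Fin m → Bool
  v k = u k xor digitShift m a σ c k
  e : Bool
  e = c xor σ (fromℕ m)

mean-xInit : ∀ m → mean m (xInit m) ≡ ½ * (½ * (1ℚ - 2^- m))
mean-xInit zero    = refl
mean-xInit (suc m) = begin
  mean (suc m) (xInit (suc m))
    ≡⟨ mean-∷-+ m (λ b → ⟦ b ⟧ * q) (xInit m) ⟩
  ½ * (⟦ false ⟧ * q + ⟦ true ⟧ * q) + mean m (xInit m)
    ≡⟨ cong (½ * (⟦ false ⟧ * q + ⟦ true ⟧ * q) +_) (mean-xInit m) ⟩
  ½ * (⟦ false ⟧ * q + ⟦ true ⟧ * q) + ½ * (½ * (1ℚ - 2^- m))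
    ≡⟨ solve 1 (λ p → con ½ :* (con 0ℚ :* (con ½ :* (con ½ :* p)) :+ con 1ℚ :* (con ½ :* (con ½ :* p)))
                        :+ con ½ :* (con ½ :* (con 1ℚ :- p))
                    := con ½ :* (con ½ :* (con 1ℚ :- con ½ :* p)))
             refl (2^- m) ⟩
  ½ * (½ * (1ℚ - 2^- (suc m))) ∎
  where
  open ≡-Reasoning
  q : ℚ
  q = 2^- (suc (suc m))

mean-shiftedDigits : ∀ m τ e →
  mean m (shiftedDigits m τ e) ≡ ½ * (1ℚ - 2^- m) + ⟦ e ⟧ * (½ * 2^- m)
mean-shiftedDigits zero    τ false = refl
mean-shiftedDigits zero    τ true  = refl
mean-shiftedDigits (suc m) τ e = begin
  mean (suc m) (shiftedDigits (suc m) τ e)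
    ≡⟨ mean-∷-+ m (λ b → ½ * ⟦ b xor τ zero ⟧) (λ u → ½ * shiftedDigits m τ′ e u) ⟩
  ½ * (½ * ⟦ τ zero ⟧ + ½ * ⟦ not (τ zero) ⟧) + mean m (λ u → ½ * shiftedDigits m τ′ e u)
    ≡⟨ cong₂ (λ x y → ½ * (½ * ⟦ τ zero ⟧ + ½ * x) + y)
             (⟦not⟧≡1-⟦⟧ (τ zero)) (mean-* m ½ (shiftedDigits m τ′ e)) ⟩
  ½ * (½ * ⟦ τ zero ⟧ + ½ * (1ℚ - ⟦ τ zero ⟧)) + ½ * mean m (shiftedDigits m τ′ e)
    ≡⟨ cong (λ x → ½ * (½ * ⟦ τ zero ⟧ + ½ * (1ℚ - ⟦ τ zero ⟧)) + ½ * x) (mean-shiftedDigits m τ′ e) ⟩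
  ½ * (½ * ⟦ τ zero ⟧ + ½ * (1ℚ - ⟦ τ zero ⟧)) + ½ * (½ * (1ℚ - 2^- m) + ⟦ e ⟧ * (½ * 2^- m))
    ≡⟨ solve 3 (λ t e p → con ½ :* (con ½ :* t :+ con ½ :* (con 1ℚ :- t))
                            :+ con ½ :* (con ½ :* (con 1ℚ :- p) :+ e :* (con ½ :* p))
                        := con ½ :* (con 1ℚ :- con ½ :* p) :+ e :* (con ½ :* (con ½ :* p)))
             refl ⟦ τ zero ⟧ ⟦ e ⟧ (2^- m) ⟩
  ½ * (1ℚ - 2^- (suc m)) + ⟦ e ⟧ * (½ * 2^- (suc m)) ∎
  where
  open ≡-Reasoning
  τ′ : Fin m → Bool
  τ′ k = τ (suc k)

shiftedDigits-bounds : ∀ m τ e u → 0ℚ ≤ shiftedDigits m τ e u × shiftedDigits m τ e u ≤ 1ℚ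
shiftedDigits-bounds m τ e u =
  0≤digits (suc m) ((λ k → u k xor τ k) ∷ʳ e) , digits≤1 (suc m) ((λ k → u k xor τ k) ∷ʳ e)

haarMoment : (m : ℕ) → (Fin m → Bool) → Bool → ℚ → (j : ℕ) → (Fin j → Bool) → ℚ
haarMoment m τ e A j s =
  mean m (λ u → (A - xInit m u) * haarFrom (digits j s) (2^- j) (shiftedDigits m τ e u))

haarMoment-step : ∀ m τ e A j s →
  haarMoment (suc m) τ e A (suc j) s
    ≡ ½ * (½ * haarMoment m (λ k → τ (suc k)) e (A - ⟦ s zero xor τ zero ⟧ * 2^- (suc (suc m)))
                          j (λ i → s (suc i)))
haarMoment-step m τ e A j s = begin
  mean (suc m) F                 ≡⟨ mean-∷-at m F b⋆ F-other ⟩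
  ½ * mean m (λ u → F (b⋆ ∷ u))  ≡⟨ cong (½ *_) (mean-cong m F-match) ⟩
  ½ * mean m (λ u → ½ * G u)     ≡⟨ cong (½ *_) (mean-* m ½ G) ⟩
  ½ * (½ * mean m G)             ∎
  where
  open ≡-Reasoning
  τ′ : Fin m → Bool
  τ′ k = τ (suc k)
  s′ : Fin j → Bool
  s′ i = s (suc i)
  q : ℚ
  q = 2^- (suc (suc m))
  -- the only value of the next digit of u that keeps y in the support of h_{j+1,s}
  b⋆ : Bool
  b⋆ = s zero xor τ zero
  F : (Fin (suc m) → Bool) → ℚ
  F u = (A - xInit (suc m) u) * haarFrom (digits (suc j) s) (2^- (suc j)) (shiftedDigits (suc m) τ e u)
  G : (Fin m → Bool) → ℚ
  G u = (A - ⟦ b⋆ ⟧ * q - xInit m u) * haarFrom (digits j s′) (2^- j) (shiftedDigits m τ′ e u)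

  F-match : ∀ u → F (b⋆ ∷ u) ≡ ½ * G u
  F-match u = begin
    (A - (⟦ b⋆ ⟧ * q + x)) * haarFrom ℓ (½ * 2^- j) (½ * ⟦ b⋆ xor τ zero ⟧ + ½ * y)
      ≡⟨ cong (λ d → (A - (⟦ b⋆ ⟧ * q + x)) * haarFrom ℓ (½ * 2^- j) (½ * ⟦ d ⟧ + ½ * y))
              (xor-cancelʳ (s zero) (τ zero)) ⟩
    (A - (⟦ b⋆ ⟧ * q + x)) * haarFrom ℓ (½ * 2^- j) (½ * ⟦ s zero ⟧ + ½ * y)
      ≡⟨ cong ((A - (⟦ b⋆ ⟧ * q + x)) *_) (haarFrom-zoom (½ * ⟦ s zero ⟧) (digits j s′) (2^- j) y) ⟩
    (A - (⟦ b⋆ ⟧ * q + x)) * (½ * haarFrom (digits j s′) (2^- j) y)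
      ≡⟨ solve 4 (λ a b x h → (a :- (b :+ x)) :* (con ½ :* h) := con ½ :* ((a :- b :- x) :* h))
               refl A (⟦ b⋆ ⟧ * q) x (haarFrom (digits j s′) (2^- j) y) ⟩
    ½ * G u ∎
    where
    x y ℓ : ℚ
    x = xInit m u
    y = shiftedDigits m τ′ e u
    ℓ = digits (suc j) s

  F-other : ∀ u → F (not b⋆ ∷ u) ≡ 0ℚ
  F-other u = trans (cong ((A - (⟦ not b⋆ ⟧ * q + xInit m u)) *_) y-outside)
                    (QP.*-zeroʳ (A - (⟦ not b⋆ ⟧ * q + xInit m u)))
    where
    y : ℚ
    y = shiftedDigits m τ′ e u
    y-outside : haarFrom (digits (suc j) s) (2^- (suc j)) (½ * ⟦ not b⋆ xor τ zero ⟧ + ½ * y) ≡ 0ℚ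
    y-outside =
      trans (cong (λ d → haarFrom (digits (suc j) s) (2^- (suc j)) (½ * ⟦ d ⟧ + ½ * y))
                  (trans (sym (not-distribˡ-xor b⋆ (τ zero))) (cong not (xor-cancelʳ (s zero) (τ zero)))))
            (haarFrom-digits-otherChild j s (proj₁ (shiftedDigits-bounds m τ′ e u))
                                            (proj₂ (shiftedDigits-bounds m τ′ e u)))

sign : Bool → Bool → ℚ
sign t e = (1ℚ - ⟦ e ⟧) * (1ℚ - (⟦ t ⟧ + ⟦ t ⟧))

baseMoment : ℕ → Bool → Bool → ℚ
baseMoment r t e = 2^- 4 - 2^- r * 2^- 5 + 2^- r * 2^- r * 2^- 5 * sign t e

haarMoment-base : ∀ r τ e A s → haarMoment (suc r) τ e A 0 s ≡ baseMoment r (τ zero) e - ½ * (½ * A)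
haarMoment-base r τ e A s = begin
  mean (suc r) F
    ≡⟨ mean-∷-pair r F ⟩
  ½ * mean r (λ u → F (false ∷ u) + F (true ∷ u))
    ≡⟨ cong (½ *_) (mean-cong r (λ u → haarFrom-unit-pair (τ zero) A q (xInit r u)
                                          (proj₁ (shiftedDigits-bounds r τ′ e u))
                                          (proj₂ (shiftedDigits-bounds r τ′ e u)))) ⟩
  ½ * mean r (λ u → α + ½ * xInit r u + γ * shiftedDigits r τ′ e u)
    ≡⟨ cong (½ *_) (mean-linear r α ½ γ (xInit r) (shiftedDigits r τ′ e)) ⟩
  ½ * (α + ½ * mean r (xInit r) + γ * mean r (shiftedDigits r τ′ e))
    ≡⟨ cong₂ (λ x y → ½ * (α + ½ * x + γ * y)) (mean-xInit r) (mean-shiftedDigits r τ′ e) ⟩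
  ½ * (α + ½ * (½ * (½ * (1ℚ - R))) + γ * (½ * (1ℚ - R) + ⟦ e ⟧ * (½ * R)))
    ≡⟨ solve 4 (λ t e R A →
         con ½ :* ((con ½ :* (con ½ :* (con ½ :* R)) :* (con 1ℚ :- t) :- con ½ :* A)
                   :+ con ½ :* (con ½ :* (con ½ :* (con 1ℚ :- R)))
                   :+ (con ½ :* (con ½ :* R)) :* (t :- con ½) :* (con ½ :* (con 1ℚ :- R) :+ e :* (con ½ :* R)))
         := con (2^- 4) :- R :* con (2^- 5) :+ R :* R :* con (2^- 5) :* ((con 1ℚ :- e) :* (con 1ℚ :- (t :+ t)))
            :- con ½ :* (con ½ :* A))
         refl ⟦ τ zero ⟧ ⟦ e ⟧ R A ⟩
  baseMoment r (τ zero) e - ½ * (½ * A) ∎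
  where
  open ≡-Reasoning
  τ′ : Fin r → Bool
  τ′ k = τ (suc k)
  R q α γ : ℚ
  R = 2^- r
  q = 2^- (suc (suc r))
  α = ½ * q * (1ℚ - ⟦ τ zero ⟧) - ½ * A
  γ = q * (⟦ τ zero ⟧ - ½)
  F : (Fin (suc r) → Bool) → ℚ
  F u = (A - xInit (suc r) u) * haarFrom 0ℚ 1ℚ (shiftedDigits (suc r) τ e u)

xForced : (j r : ℕ) → (Fin (j N.+ suc r) → Bool) → (Fin j → Bool) → ℚ
xForced j r τ s = ΣFin j (λ i → ⟦ s i xor bitAt τ (toℕ i) ⟧ * 2^- (suc (j N.+ suc r) ∸ toℕ i))

haarMoment-closed : ∀ j r τ e A s →
  haarMoment (j N.+ suc r) τ e A j s
    ≡ 2^- j * 2^- j * (baseMoment r (bitAt τ j) e - ½ * (½ * (A - xForced j r τ s)))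
haarMoment-closed zero    r τ e A s =
  trans (haarMoment-base r τ e A s)
        (solve 2 (λ b A → b :- con ½ :* (con ½ :* A) := con 1ℚ :* con 1ℚ :* (b :- con ½ :* (con ½ :* (A :- con 0ℚ))))
               refl (baseMoment r (τ zero) e) A)
haarMoment-closed (suc j) r τ e A s = begin
  haarMoment (suc (j N.+ suc r)) τ e A (suc j) s
    ≡⟨ haarMoment-step (j N.+ suc r) τ e A j s ⟩
  ½ * (½ * haarMoment (j N.+ suc r) τ′ e (A - d * q) j s′)
    ≡⟨ cong (λ x → ½ * (½ * x)) (haarMoment-closed j r τ′ e (A - d * q) s′) ⟩
  ½ * (½ * (P * P * (B - ½ * (½ * (A - d * q - X)))))
    ≡⟨ solve 6 (λ P B A d q X → con ½ :* (con ½ :* (P :* P :* (B :- con ½ :* (con ½ :* (A :- d :* q :- X)))))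
                             := con ½ :* P :* (con ½ :* P) :* (B :- con ½ :* (con ½ :* (A :- (d :* q :+ X)))))
             refl P B A d q X ⟩
  2^- (suc j) * 2^- (suc j) * (baseMoment r (bitAt τ (suc j)) e - ½ * (½ * (A - xForced (suc j) r τ s))) ∎
  where
  open ≡-Reasoning
  τ′ : Fin (j N.+ suc r) → Bool
  τ′ k = τ (suc k)
  s′ : Fin j → Bool
  s′ i = s (suc i)
  d q P B X : ℚ
  d = ⟦ s zero xor τ zero ⟧
  q = 2^- (suc (suc (j N.+ suc r)))
  P = 2^- j
  B = baseMoment r (bitAt τ′ j) e
  X = xForced j r τ′ s′

right≡left+2^-j : ∀ j B → right j B ≡ left j B + 2^- j
right≡left+2^-j j B =
  trans (cong (_* 2^- j) (ℕ→ℚ-suc B))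
        (solve 2 (λ n p → (con 1ℚ :+ n) :* p := n :* p :+ p) refl (ℕ→ℚ B) (2^- j))

left≡digits : ∀ j s → left j (binNat j s) ≡ digits j s
left≡digits zero    s = refl
left≡digits (suc j) s = begin
  ℕ→ℚ (T N.+ B) * (½ * 2^- j)
    ≡⟨ cong (_* (½ * 2^- j)) (ℕ→ℚ-+ T B) ⟩
  (ℕ→ℚ T + ℕ→ℚ B) * (½ * 2^- j)
    ≡⟨ solve 3 (λ t b p → (t :+ b) :* (con ½ :* p) := con ½ :* (t :* p) :+ con ½ :* (b :* p))
             refl (ℕ→ℚ T) (ℕ→ℚ B) (2^- j) ⟩
  ½ * (ℕ→ℚ T * 2^- j) + ½ * (ℕ→ℚ B * 2^- j)
    ≡⟨ cong₂ (λ x y → ½ * x + ½ * y) (leading (s zero)) (left≡digits j s′) ⟩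
  ½ * ⟦ s zero ⟧ + ½ * digits j s′ ∎
  where
  open ≡-Reasoning
  s′ : Fin j → Bool
  s′ i = s (suc i)
  T B : ℕ
  T = if s zero then 2 N.^ j else 0
  B = binNat j s′
  leading : ∀ b → ℕ→ℚ (if b then 2 N.^ j else 0) * 2^- j ≡ ⟦ b ⟧
  leading true  = ℕ→ℚ[2^n]*2^-n≡1 j
  leading false = QP.*-zeroˡ (2^- j)

intIndFrom-hjm : ∀ j s z → intIndFrom (hjm j (binNat j s)) z ≡ haarFrom (digits j s) (2^- j) z
intIndFrom-hjm j s z =
  trans (cong (λ r → measFrom z L (L + ½ * 2^- j) - measFrom z (L + ½ * 2^- j) r)
              (right≡left+2^-j j (binNat j s)))
        (cong (λ ℓ → haarFrom ℓ (2^- j) z) (left≡digits j s))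
  where
  L : ℚ
  L = left j (binNat j s)

intT-hjm : ∀ j B → intT (hjm j B) ≡ - (½ * (½ * (2^- j * 2^- j)))
intT-hjm j B =
  trans (cong (λ r → intId (left j B) (mid j B) - intId (mid j B) r) (right≡left+2^-j j B))
        (solve 2 (λ l p → con ½ :* ((l :+ con ½ :* p) :* (l :+ con ½ :* p) :- l :* l)
                          :- con ½ :* ((l :+ p) :* (l :+ p) :- (l :+ con ½ :* p) :* (l :+ con ½ :* p))
                          := :- (con ½ :* (con ½ :* (p :* p))))
               refl (left j B) (2^- j))

integrand-∷ʳ : ∀ m a σ j s c u →
  intIndFrom h₋₁ (xCoord m (u ∷ʳ c)) * intIndFrom (hjm j (binNat j s)) (yCoord m a σ (u ∷ʳ c))
    ≡ (1ℚ - ⟦ c ⟧ * ½ - xInit m u)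
      * haarFrom (digits j s) (2^- j) (shiftedDigits m (digitShift m a σ c) (c xor σ (fromℕ m)) u)
integrand-∷ʳ m a σ j s c u = cong₂ _*_
  (begin
    measFrom (xCoord m (u ∷ʳ c)) 0ℚ 1ℚ     ≡⟨ cong (λ x → measFrom x 0ℚ 1ℚ) (xCoord-∷ʳ m u c) ⟩
    measFrom (xInit m u + ⟦ c ⟧ * ½) 0ℚ 1ℚ  ≡⟨ measFrom-inside (proj₁ (xCoord-∷ʳ-bounds m u c))
                                                              (proj₂ (xCoord-∷ʳ-bounds m u c)) ⟩
    1ℚ - (xInit m u + ⟦ c ⟧ * ½)            ≡⟨ solve 2 (λ x c → con 1ℚ :- (x :+ c) := con 1ℚ :- c :- x)
                                                       refl (xInit m u) (⟦ c ⟧ * ½) ⟩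
    1ℚ - ⟦ c ⟧ * ½ - xInit m u              ∎)
  (trans (intIndFrom-hjm j s (yCoord m a σ (u ∷ʳ c)))
         (cong (haarFrom (digits j s) (2^- j)) (yCoord-∷ʳ m a σ u c)))
  where open ≡-Reasoning

haarCoeff-as-moments : ∀ m a σ j s →
  haarCoeff m a σ h₋₁ (hjm j (binNat j s))
    ≡ ½ * (haarMoment m (digitShift m a σ false) (false xor σ (fromℕ m)) (1ℚ - ⟦ false ⟧ * ½) j s
         + haarMoment m (digitShift m a σ true) (true xor σ (fromℕ m)) (1ℚ - ⟦ true ⟧ * ½) j s)
      + ½ * (½ * (½ * (2^- j * 2^- j)))
haarCoeff-as-moments m a σ j s = begin
  mean (suc m) Φ - ½ * intT (hjm j (binNat j s))
    ≡⟨ cong₂ _-_ (mean-∷ʳ m Φ) (cong (½ *_) (intT-hjm j (binNat j s))) ⟩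
  ½ * (mean m (λ u → Φ (u ∷ʳ false)) + mean m (λ u → Φ (u ∷ʳ true))) - ½ * (- (½ * (½ * P²)))
    ≡⟨ cong₂ (λ x y → ½ * (x + y) - ½ * (- (½ * (½ * P²))))
             (mean-cong m (integrand-∷ʳ m a σ j s false)) (mean-cong m (integrand-∷ʳ m a σ j s true)) ⟩
  ½ * (M false + M true) - ½ * (- (½ * (½ * P²)))
    ≡⟨ solve 2 (λ x p → x :- con ½ :* (:- (con ½ :* (con ½ :* p))) := x :+ con ½ :* (con ½ :* (con ½ :* p)))
             refl (½ * (M false + M true)) P² ⟩
  ½ * (M false + M true) + ½ * (½ * (½ * P²)) ∎
  where
  open ≡-Reasoning
  P² : ℚ
  P² = 2^- j * 2^- j
  Φ : (Fin (suc m) → Bool) → ℚ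
  Φ t = intIndFrom h₋₁ (xCoord m t) * intIndFrom (hjm j (binNat j s)) (yCoord m a σ t)
  M : Bool → ℚ
  M c = haarMoment m (digitShift m a σ c) (c xor σ (fromℕ m)) (1ℚ - ⟦ c ⟧ * ½) j s

bitAt-fromℕ : ∀ m (v : Fin (suc m) → Bool) → bitAt v m ≡ v (fromℕ m)
bitAt-fromℕ zero    v = refl
bitAt-fromℕ (suc m) v = bitAt-fromℕ m (λ i → v (suc i))

bitAt-digitShift : ∀ m a σ c {k} → k < m → bitAt (digitShift m a σ c) k ≡ (bitAt a k ∧ c) xor bitAt σ k
bitAt-digitShift (suc m) a σ c {zero}  _         = refl
bitAt-digitShift (suc m) a σ c {suc k} (s≤s k<m) = bitAt-digitShift m (λ i → a (suc i)) (λ i → σ (suc i)) c k<m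

-- Only c = γ has last digit c xor γ = false, and there the digit is (α ∧ γ) xor β.
sign-sum : ∀ α β γ →
  sign ((α ∧ false) xor β) (false xor γ) + sign ((α ∧ true) xor β) (true xor γ)
    ≡ 1ℚ - (⟦ β xor (α ∧ γ) ⟧ + ⟦ β xor (α ∧ γ) ⟧)
sign-sum false false false = refl
sign-sum false false true  = refl
sign-sum false true  false = refl
sign-sum false true  true  = refl
sign-sum true  false false = refl
sign-sum true  false true  = refl
sign-sum true  true  false = refl
sign-sum true  true  true  = refl

lastDigit-signs : ∀ m a σ {j} → j < m →
  sign (bitAt (digitShift m a σ false) j) (false xor σ (fromℕ m))
    + sign (bitAt (digitShift m a σ true) j) (true xor σ (fromℕ m))
    ≡ 1ℚ - (⟦ bitAt σ j xor (bitAt a j ∧ bitAt σ m) ⟧ + ⟦ bitAt σ j xor (bitAt a j ∧ bitAt σ m) ⟧)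
lastDigit-signs m a σ {j} j<m
  rewrite bitAt-digitShift m a σ false j<m | bitAt-digitShift m a σ true j<m | bitAt-fromℕ m σ
  = sign-sum (bitAt a j) (bitAt σ j) (σ (fromℕ m))

xForced-sum : ∀ j r a σ s → let m = j N.+ suc r in
  xForced j r (digitShift m a σ false) s + xForced j r (digitShift m a σ true) s
    ≡ ΣFin j (λ i → (⟦ s i xor bitAt σ (toℕ i) ⟧ + ⟦ s i xor (bitAt σ (toℕ i) xor bitAt a (toℕ i)) ⟧)
                     * 2^- (suc m ∸ toℕ i))
xForced-sum j r a σ s = trans (sym (ΣFin-+ j _ _)) (ΣFin-cong j termwise)
  where
  m : ℕ
  m = j N.+ suc r
  termwise : ∀ i →
    ⟦ s i xor bitAt (digitShift m a σ false) (toℕ i) ⟧ * 2^- (suc m ∸ toℕ i)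
      + ⟦ s i xor bitAt (digitShift m a σ true) (toℕ i) ⟧ * 2^- (suc m ∸ toℕ i)
    ≡ (⟦ s i xor bitAt σ (toℕ i) ⟧ + ⟦ s i xor (bitAt σ (toℕ i) xor bitAt a (toℕ i)) ⟧) * 2^- (suc m ∸ toℕ i)
  termwise i = trans
    (cong₂ (λ x y → ⟦ s i xor x ⟧ * 2^- (suc m ∸ toℕ i) + ⟦ s i xor y ⟧ * 2^- (suc m ∸ toℕ i))
           (trans (bitAt-digitShift m a σ false i<m) (cong (_xor β) (∧-zeroʳ α)))
           (trans (bitAt-digitShift m a σ true i<m) (trans (cong (_xor β) (∧-identityʳ α)) (xor-comm α β))))
    (sym (QP.*-distribʳ-+ (2^- (suc m ∸ toℕ i)) ⟦ s i xor β ⟧ ⟦ s i xor (β xor α) ⟧))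
    where
    α β : Bool
    α = bitAt a (toℕ i)
    β = bitAt σ (toℕ i)
    i<m : toℕ i < m
    i<m = NP.<-≤-trans (FP.toℕ<n i) (NP.m≤m+n j (suc r))

2^-‿exponents : ∀ j r w S → let n = suc (j N.+ suc r); P = 2^- j; R = 2^- r in
  2^- (2 N.* n N.+ 2) - 2^- (n N.+ j N.+ 3) - 2^- (2 N.* n N.+ 1) * w + 2^- (2 N.* j N.+ 3) * S
    ≡ P * P * (R * R) * 2^- 6 - P * P * R * 2^- 5 - P * P * (R * R) * 2^- 5 * w + P * P * 2^- 3 * S
2^-‿exponents j r w S =
  cong₂ _+_ (cong₂ _-_ (cong₂ _-_ 2^-[2n+2] 2^-[n+j+3]) (cong (_* w) 2^-[2n+1])) (cong (_* S) 2^-[2j+3])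
  where
  P R : ℚ
  P = 2^- j
  R = 2^- r
  P² : 2^- (j N.+ j) ≡ P * P
  P² = 2^-[m+n]≡2^-m*2^-n j j
  R² : 2^- (r N.+ r) ≡ R * R
  R² = 2^-[m+n]≡2^-m*2^-n r r
  2^-[2n+2] : 2^- (2 N.* suc (j N.+ suc r) N.+ 2) ≡ P * P * (R * R) * 2^- 6
  2^-[2n+2] = trans (cong 2^-_ (eq j r))
                    (trans (2^-[a+b+c]≡2^-a*2^-b*2^-c (j N.+ j) (r N.+ r) 6) (cong (_* 2^- 6) (cong₂ _*_ P² R²)))
    where
    eq : ∀ j r → 2 N.* suc (j N.+ suc r) N.+ 2 ≡ j N.+ j N.+ (r N.+ r) N.+ 6
    eq = solve-∀
  2^-[n+j+3] : 2^- (suc (j N.+ suc r) N.+ j N.+ 3) ≡ P * P * R * 2^- 5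
  2^-[n+j+3] = trans (cong 2^-_ (eq j r))
                     (trans (2^-[a+b+c]≡2^-a*2^-b*2^-c (j N.+ j) r 5) (cong (λ x → x * R * 2^- 5) P²))
    where
    eq : ∀ j r → suc (j N.+ suc r) N.+ j N.+ 3 ≡ j N.+ j N.+ r N.+ 5
    eq = solve-∀
  2^-[2n+1] : 2^- (2 N.* suc (j N.+ suc r) N.+ 1) ≡ P * P * (R * R) * 2^- 5
  2^-[2n+1] = trans (cong 2^-_ (eq j r))
                    (trans (2^-[a+b+c]≡2^-a*2^-b*2^-c (j N.+ j) (r N.+ r) 5) (cong (_* 2^- 5) (cong₂ _*_ P² R²)))
    where
    eq : ∀ j r → 2 N.* suc (j N.+ suc r) N.+ 1 ≡ j N.+ j N.+ (r N.+ r) N.+ 5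
    eq = solve-∀
  2^-[2j+3] : 2^- (2 N.* j N.+ 3) ≡ P * P * 2^- 3
  2^-[2j+3] = trans (cong 2^-_ (eq j)) (trans (2^-[m+n]≡2^-m*2^-n (j N.+ j) 3) (cong (_* 2^- 3) P²))
    where
    eq : ∀ j → 2 N.* j N.+ 3 ≡ j N.+ j N.+ 3
    eq = solve-∀

haarCoeff-algebra : ∀ j r {t₀ e₀ t₁ e₁ : Bool} {X₀ X₁ w S : ℚ} →
  sign t₀ e₀ + sign t₁ e₁ ≡ 1ℚ - (w + w) → X₀ + X₁ ≡ S →
  let P = 2^- j; n = suc (j N.+ suc r) in
  ½ * (P * P * (baseMoment r t₀ e₀ - ½ * (½ * (1ℚ - ⟦ false ⟧ * ½ - X₀)))
     + P * P * (baseMoment r t₁ e₁ - ½ * (½ * (1ℚ - ⟦ true ⟧ * ½ - X₁))))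
    + ½ * (½ * (½ * (P * P)))
  ≡ 2^- (2 N.* n N.+ 2) - 2^- (n N.+ j N.+ 3) - 2^- (2 N.* n N.+ 1) * w + 2^- (2 N.* j N.+ 3) * S
haarCoeff-algebra j r {t₀} {e₀} {t₁} {e₁} {X₀} {X₁} {w} {S} signs forced = begin
  ½ * (P * P * (baseMoment r t₀ e₀ - ½ * (½ * (1ℚ - ⟦ false ⟧ * ½ - X₀)))
     + P * P * (baseMoment r t₁ e₁ - ½ * (½ * (1ℚ - ⟦ true ⟧ * ½ - X₁))))
    + ½ * (½ * (½ * (P * P)))
    ≡⟨ solve 6 (λ P R x₀ x₁ X₀ X₁ →
         con ½ :* (P :* P :* (B R x₀ :- con ½ :* (con ½ :* (con 1ℚ :- con 0ℚ :* con ½ :- X₀)))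
                   :+ P :* P :* (B R x₁ :- con ½ :* (con ½ :* (con 1ℚ :- con 1ℚ :* con ½ :- X₁))))
           :+ con ½ :* (con ½ :* (con ½ :* (P :* P)))
         := T P R (x₀ :+ x₁ :- con 1ℚ) (X₀ :+ X₁))
         refl P R (sign t₀ e₀) (sign t₁ e₁) X₀ X₁ ⟩
  P * P * (R * R) * 2^- 6 - P * P * R * 2^- 5
    + P * P * (R * R) * 2^- 6 * (sign t₀ e₀ + sign t₁ e₁ - 1ℚ) + P * P * 2^- 3 * (X₀ + X₁)
    ≡⟨ cong₂ (λ x y → P * P * (R * R) * 2^- 6 - P * P * R * 2^- 5
                      + P * P * (R * R) * 2^- 6 * (x - 1ℚ) + P * P * 2^- 3 * y)
             signs forced ⟩
  P * P * (R * R) * 2^- 6 - P * P * R * 2^- 5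
    + P * P * (R * R) * 2^- 6 * (1ℚ - (w + w) - 1ℚ) + P * P * 2^- 3 * S
    ≡⟨ solve 4 (λ P R w S →
         T P R (con 1ℚ :- (w :+ w) :- con 1ℚ) S
         := P :* P :* (R :* R) :* con (2^- 6) :- P :* P :* R :* con (2^- 5)
            :- P :* P :* (R :* R) :* con (2^- 5) :* w :+ P :* P :* con (2^- 3) :* S)
         refl P R w S ⟩
  P * P * (R * R) * 2^- 6 - P * P * R * 2^- 5 - P * P * (R * R) * 2^- 5 * w + P * P * 2^- 3 * S
    ≡⟨ 2^-‿exponents j r w S ⟨
  2^- (2 N.* n N.+ 2) - 2^- (n N.+ j N.+ 3) - 2^- (2 N.* n N.+ 1) * w + 2^- (2 N.* j N.+ 3) * S ∎
  where
  open ≡-Reasoning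
  n : ℕ
  n = suc (j N.+ suc r)
  P R : ℚ
  P = 2^- j
  R = 2^- r
  B : ∀ {k} → Polynomial k → Polynomial k → Polynomial k
  B R x = con (2^- 4) :- R :* con (2^- 5) :+ R :* R :* con (2^- 5) :* x
  T : ∀ {k} → Polynomial k → Polynomial k → Polynomial k → Polynomial k → Polynomial k
  T P R x X = P :* P :* (R :* R) :* con (2^- 6) :- P :* P :* R :* con (2^- 5)
              :+ P :* P :* (R :* R) :* con (2^- 6) :* x :+ P :* P :* con (2^- 3) :* X

<⇒≡+suc : ∀ {j m} → j < m → ∃[ r ] m ≡ j N.+ suc r
<⇒≡+suc {j} j<m with NP.m≤n⇒∃[o]m+o≡n j<m
... | r , 1+j+r≡m = r , trans (sym 1+j+r≡m) (sym (NP.+-suc j r))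

proposition2 : (m : ℕ) (a : Fin m → Bool) (σ : Fin (suc m) → Bool)
    (j₂ : ℕ) → j₂ < m → (s : Fin j₂ → Bool) →
    haarCoeff m a σ h₋₁ (hjm j₂ (binNat j₂ s))
      ≡ 2^- (2 N.* suc m N.+ 2) - 2^- (suc m N.+ j₂ N.+ 3)
        - 2^- (2 N.* suc m N.+ 1)
          * ⟦ bitAt σ j₂ xor (bitAt a j₂ ∧ bitAt σ m) ⟧
        + 2^- (2 N.* j₂ N.+ 3)
          * ΣFin j₂ (λ i → (⟦ s i xor bitAt σ (toℕ i) ⟧
                             + ⟦ s i xor (bitAt σ (toℕ i) xor bitAt a (toℕ i)) ⟧)
                           * 2^- (suc m ∸ toℕ i))
proposition2 m a σ j j<m s with <⇒≡+suc j<m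
... | r , refl = begin
  haarCoeff m a σ h₋₁ (hjm j (binNat j s))
    ≡⟨ haarCoeff-as-moments m a σ j s ⟩
  ½ * (moment false + moment true) + ½ * (½ * (½ * (2^- j * 2^- j)))
    ≡⟨ cong₂ (λ x y → ½ * (x + y) + ½ * (½ * (½ * (2^- j * 2^- j))))
             (moment-closed false) (moment-closed true) ⟩
  ½ * (closed false + closed true) + ½ * (½ * (½ * (2^- j * 2^- j)))
    ≡⟨ haarCoeff-algebra j r {t false} {e false} {t true} {e true} {X false} {X true}
                         (lastDigit-signs m a σ j<m) (xForced-sum j r a σ s) ⟩
  _ ∎
  where
  open ≡-Reasoning
  t e : Bool → Bool
  t c = bitAt (digitShift m a σ c) j
  e c = c xor σ (fromℕ m)
  X moment closed : Bool → ℚ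
  X c = xForced j r (digitShift m a σ c) s
  moment c = haarMoment m (digitShift m a σ c) (e c) (1ℚ - ⟦ c ⟧ * ½) j s
  closed c = 2^- j * 2^- j * (baseMoment r (t c) (e c) - ½ * (½ * (1ℚ - ⟦ c ⟧ * ½ - X c)))
  moment-closed : ∀ c → moment c ≡ closed c
  moment-closed c = haarMoment-closed j r (digitShift m a σ c) (e c) (1ℚ - ⟦ c ⟧ * ½) s
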